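{- Let $a_1,\dots,a_n$ be pairwise coprime positive integers and $\mathcal{T}=[0,a_1]\times\cdots\times[0,a_n]$. For $v\in\mathcal{T}\cap\mathbb{N}^n$ let $I(v)=\{i\in[n]: v_i=0 \text{ or } v_i=a_i\}$, and for $0\le k\le n$ let $b_k$ be the number of points $v\in\mathcal{T}\cap\mathbb{N}^n$ with $|I(v)|=k$ and $m_{\mathcal{T}}(v)>0$. Then for every $0\le k\le n$, $$b_k=2^{1-n+k}\sum_{\substack{J\subseteq[n]\\ |J|=k}}\ \prod_{j\in[n]\setminus J}(a_j-1).$$
   Context: A corner of $\mathcal{T}$ is a point $w$ with $w_i\in\{0,a_i\}$ for all $i$. The billiard trajectory is the curve $\gamma$ starting at the origin with direction $d=(1,\dots,1)$, moving in a straight line; whenever it reaches the boundary hyperplane $x_i=0$ or $x_i=a_i$, the $i$-th component of its current direction is negated (several components simultaneously if several such hyperplanes are reached at once), and the motion stops when it reaches a corner other than the origin. Parametrize $\gamma:[0,L]\to\mathcal{T}$ so that on each linear piece $\gamma'(t)\in\{ -1,1\}^n$. The crossing number $m_{\mathcal{T}}(v)$ is the number of parameters $t\in[0,L]$ with $\gamma(t)=v$ (so the start and end corners have crossing number $1$). Here $\mathbb{N}$ includes $0$. -}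

module Defs where

open import Data.Nat using (ℕ; zero; suc; _+_; _*_; _∸_; _≡ᵇ_)
open import Data.Bool using (Bool; true; false; if_then_else_; _∧_; _∨_; not)
open import Data.Product using (_×_; _,_; proj₁; proj₂)
open import Data.List using (List; []; _∷_; map; concatMap; upTo; length; filterᵇ)
open import Data.Nat.ListAction using (sum)
open import Data.Vec using (Vec; []; _∷_; replicate; zipWith)
import Data.Vec as V
open import Data.Fin.Subset using (Subset; ∣_∣; inside; outside)

boxPoints : ∀ {n} → Vec ℕ n → List (Vec ℕ n)
boxPoints []       = [] ∷ []
boxPoints (a ∷ as) = concatMap (λ x → map (x ∷_) (boxPoints as)) (upTo (suc a))

boundaryCount : ∀ {n} → Vec ℕ n → Vec ℕ n → ℕ
boundaryCount []       []       = 0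
boundaryCount (a ∷ as) (x ∷ xs) =
  (if (x ≡ᵇ 0) ∨ (x ≡ᵇ a) then 1 else 0) + boundaryCount as xs

isCorner : ∀ {n} → Vec ℕ n → Vec ℕ n → Bool
isCorner []       []       = true
isCorner (a ∷ as) (x ∷ xs) = ((x ≡ᵇ 0) ∨ (x ≡ᵇ a)) ∧ isCorner as xs

vecEqᵇ : ∀ {n} → Vec ℕ n → Vec ℕ n → Bool
vecEqᵇ []       []       = true
vecEqᵇ (x ∷ xs) (y ∷ ys) = (x ≡ᵇ y) ∧ vecEqᵇ xs ys

-- Billiard trajectory, sampled at integer times.
-- The state of one coordinate is (position, direction), direction
-- true = +1, false = -1.  One unit of time moves the coordinate by its
-- direction; if the new position lies on the hyperplane xᵢ = 0 or
-- xᵢ = aᵢ, the direction is negated.  Coordinates reflect independently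
-- (so several components flip simultaneously when several hyperplanes
-- are reached at once).

stepCoord : ℕ → ℕ × Bool → ℕ × Bool
stepCoord a (x , true)  = suc x , not (suc x ≡ᵇ a)
stepCoord a (x , false) = x ∸ 1 , (x ∸ 1 ≡ᵇ 0)

step : ∀ {n} → Vec ℕ n → Vec (ℕ × Bool) n → Vec (ℕ × Bool) n
step a s = zipWith stepCoord a s

stateAt : ∀ {n} → Vec ℕ n → ℕ → Vec (ℕ × Bool) n
stateAt {n} a zero    = replicate n (0 , true)
stateAt     a (suc t) = step a (stateAt a t)

posAt : ∀ {n} → Vec ℕ n → ℕ → Vec ℕ n
posAt a t = V.map proj₁ (stateAt a t)

firstCornerFrom : ∀ {n} → Vec ℕ n → ℕ → ℕ → ℕ
firstCornerFrom a zero       t = t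
firstCornerFrom a (suc fuel) t =
  if isCorner a (posAt a t) then t else firstCornerFrom a fuel (suc t)

-- The search bound ∏ 2aᵢ is harmless: at time ∏ 2aᵢ every
-- coordinate is back at 0 (coordinate i has period 2aᵢ), so a corner is
-- reached at some t ∈ [1, ∏ 2aᵢ] whenever all aᵢ > 0.
trajLength : ∀ {n} → Vec ℕ n → ℕ
trajLength a = firstCornerFrom a (V.foldr _ (λ x r → 2 * x * r) 1 a) 1

-- Since γ starts at a lattice point and every coordinate
-- moves with speed 1, γ(t) is a lattice point only at integer times t,
-- so it suffices to count integer t ∈ {0,…,L}.
crossingNumber : ∀ {n} → Vec ℕ n → Vec ℕ n → ℕ
crossingNumber a v =
  length (filterᵇ (λ t → vecEqᵇ (posAt a t) v) (upTo (suc (trajLength a))))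

bCount : ∀ {n} → Vec ℕ n → ℕ → ℕ
bCount a k =
  length (filterᵇ (λ v → (boundaryCount a v ≡ᵇ k) ∧ not (crossingNumber a v ≡ᵇ 0))
                  (boxPoints a))

allSubsets : ∀ n → List (Subset n)
allSubsets zero    = [] ∷ []
allSubsets (suc n) = map (inside ∷_) (allSubsets n) Data.List.++ map (outside ∷_) (allSubsets n)

prodOutside : ∀ {n} → Vec ℕ n → Subset n → ℕ
prodOutside []       []             = 1
prodOutside (a ∷ as) (true  ∷ J)    = prodOutside as J
prodOutside (a ∷ as) (false ∷ J)    = (a ∸ 1) * prodOutside as J

subsetSum : ∀ {n} → Vec ℕ n → ℕ → ℕ
subsetSum {n} a k =
  sum (map (prodOutside a) (filterᵇ (λ J → ∣ J ∣ ≡ᵇ k) (allSubsets n)))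

-- Coordinate i of the billiard path is the triangle wave of period 2aᵢ: γ(t)ᵢ = vᵢ exactly
-- when t ≡ ±vᵢ (mod 2aᵢ) with 0 ≤ vᵢ ≤ aᵢ. Hence every coordinate of γ(t) has the parity of t,
-- and γ(t) is a corner only if every aᵢ, hence (by coprimality) ∏ aᵢ, divides t, so L ≥ ∏ aᵢ.
-- Conversely, if all coordinates of a lattice point v have the same parity, the Chinese
-- remainder theorem for the moduli 2aᵢ (pairwise of gcd 2) gives t ≡ vᵢ (mod 2aᵢ) for all i,
-- and the symmetries γ(t + 2∏aᵢ) = γ(t) = γ(2∏aᵢ − t) move t into [0, ∏aᵢ]. So the visited
-- lattice points are exactly those whose coordinates all have the same parity.
-- Counting them by their number of boundary coordinates is a product over the coordinates:
-- within one parity class an odd aᵢ = 2j + 1 offers j interior values and one boundary value,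
-- while an even aᵢ = 2j + 2 offers j interior and two boundary values in the even class and
-- j + 1 interior values in the odd one. As at most one aᵢ is even, in every case
--   2ⁿ Σₖ bₖ zᵏ = 2 ∏ᵢ (aᵢ − 1 + 2z),
-- and the coefficient of zᵏ on the right is 2ᵏ⁺¹ Σ_{|J| = k} ∏_{j ∉ J} (aⱼ − 1).

module Submission where

open import Defs
open import Data.Nat using (ℕ; _*_; _+_; _^_; _≤_; _<_)
open import Data.Nat.Coprimality using (Coprime)
open import Data.Fin using (Fin)
open import Data.Vec using (Vec; lookup)
open import Relation.Binary.PropositionalEquality using (_≡_; _≢_)

open import Data.Bool.Base using (Bool; true; false; not; _∧_; _∨_; if_then_else_; T)
open import Data.Bool.Properties using (T-∧; T-∨; ∧-zeroʳ; ∧-distribˡ-∨)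
open import Data.Empty using (⊥; ⊥-elim)
open import Data.Fin.Subset using (Subset; ∣_∣)
open import Data.List.Base using (List; []; _∷_; _++_; _∷ʳ_; map; concatMap; upTo; applyUpTo; length; filterᵇ)
open import Data.List.Properties
  using (length-++; length-map; filter-++; filter-some; map-++; map-∘; map-cong; map-applyUpTo; applyUpTo-∷ʳ)
open import Data.List.Membership.Propositional using (_∈_; find; lose)
open import Data.List.Membership.Propositional.Properties using (∈-concatMap⁻; ∈-map⁻; ∈-upTo⁺; ∈-upTo⁻)
open import Data.List.Relation.Unary.Any using (here; there)
open import Data.Nat.Base using (zero; suc; _∸_; _≡ᵇ_; parity; z≤n; s≤s; z<s; s<s; NonZero; >-nonZero)
open import Data.Nat.Properties
open import Data.Nat.Coprimality using (coprime-divisor; coprime-Bézout)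
import Data.Nat.Coprimality as Coprime
open import Data.Nat.Divisibility
  using (_∣_; divides; ∣-refl; ∣-trans; _∣0; 1∣_; ∣1⇒≡1; ∣⇒≤; n∣m*n; m∣m*n; ∣n⇒∣m*n; ∣m+n∣m⇒∣n; ∣m∣n⇒∣m+n
        ; *-monoʳ-∣)
open import Data.Nat.DivMod using (_%_; _/_; m≡m%n+[m/n]*n; m%n<n)
open import Data.Nat.GCD using (module Bézout)
open import Data.Nat.ListAction using (sum)
open import Data.Nat.ListAction.Properties using (sum-++)
open import Data.Nat.Tactic.RingSolver using (solve-∀)
open import Data.Parity.Base as ℙ using (Parity; 0ℙ; 1ℙ; _⁻¹)
import Data.Parity.Properties as ℙ
open import Data.Product.Base using (_×_; _,_; proj₁; proj₂; ∃-syntax; ∃₂)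
import Data.Product.Base as Product
open import Data.Sum.Base using (_⊎_; inj₁; inj₂)
import Data.Sum.Base as Sum
open import Data.Unit.Base using (tt)
open import Data.Vec.Base as V using ([]; _∷_)
import Data.Vec.Properties as V
open import Data.Vec.Relation.Unary.All as All using (All; []; _∷_)
import Data.Vec.Relation.Unary.All.Properties as All
open import Data.Vec.Relation.Unary.AllPairs using (AllPairs; []; _∷_)
import Data.Vec.Relation.Unary.AllPairs.Properties as AllPairs
open import Data.Vec.Relation.Binary.Pointwise.Inductive using (Pointwise; []; _∷_)
open import Function.Base using (_∘_)
open import Function.Bundles using (Equivalence)
open import Relation.Nullary.Decidable using (does; yes; no; T?; dec-true; dec-false)
open import Relation.Nullary.Negation using (¬_; contradiction)
open import Relation.Binary.PropositionalEquality using (refl; sym; trans; cong; cong₂; subst; module ≡-Reasoning)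

private variable
  X Y : Set

hasParity : Parity → ℕ → Bool
hasParity p x = does (parity x ℙ.≟ p)

parity-+-even : ∀ m {n} → 2 ∣ n → parity (m + n) ≡ parity m
parity-+-even m (divides k refl) = begin
  parity (m + k * 2)              ≡⟨ ℙ.+-homo-+ m (k * 2) ⟩
  parity m ℙ.+ parity (k * 2)     ≡⟨ cong (parity m ℙ.+_) (trans (ℙ.*-homo-* k 2) (ℙ.*-zeroʳ (parity k))) ⟩
  parity m ℙ.+ 0ℙ                 ≡⟨ ℙ.+-identityʳ (parity m) ⟩
  parity m                        ∎
  where open ≡-Reasoning

parity-≡⇒∃[d]n≡m+d*2 : ∀ {m n} → parity m ≡ parity n → m ≤ n → ∃[ d ] n ≡ m + d * 2
parity-≡⇒∃[d]n≡m+d*2 {zero} {zero} _ _ = 0 , refl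
parity-≡⇒∃[d]n≡m+d*2 {zero} {suc zero} () _
parity-≡⇒∃[d]n≡m+d*2 {zero} {suc (suc n)} eq _ with parity-≡⇒∃[d]n≡m+d*2 {zero} {n} eq z≤n
... | d , refl = suc d , refl
parity-≡⇒∃[d]n≡m+d*2 {suc m} {suc n} eq (s≤s m≤n)
  with parity-≡⇒∃[d]n≡m+d*2 {m} {n} (trans (sym (ℙ.suc-homo-⁻¹ m)) (trans (cong _⁻¹ eq) (ℙ.suc-homo-⁻¹ n))) m≤n
... | d , refl = d , refl

parity[j*2] : ∀ j → parity (j * 2) ≡ 0ℙ
parity[j*2] zero    = refl
parity[j*2] (suc j) = parity[j*2] j

parity[1+j*2] : ∀ j → parity (1 + j * 2) ≡ 1ℙ
parity[1+j*2] zero    = refl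
parity[1+j*2] (suc j) = parity[1+j*2] j

odd⇒1+j*2 : ∀ {x} → parity x ≡ 1ℙ → ∃[ j ] x ≡ 1 + j * 2
odd⇒1+j*2 {suc x} x-odd = parity-≡⇒∃[d]n≡m+d*2 (sym x-odd) (s≤s z≤n)

even⇒j*2 : ∀ {x} → parity x ≡ 0ℙ → ∃[ j ] x ≡ j * 2
even⇒j*2 x-even = parity-≡⇒∃[d]n≡m+d*2 (sym x-even) z≤n

even⇒2∣ : ∀ {x} → parity x ≡ 0ℙ → 2 ∣ x
even⇒2∣ {x} x-even with even⇒j*2 {x} x-even
... | j , x≡j*2 = divides j x≡j*2

product : ∀ {n} → Vec ℕ n → ℕ
product []       = 1
product (x ∷ xs) = x * product xs

product-pos : ∀ {n} {a : Vec ℕ n} → All (0 <_) a → 0 < product a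
product-pos []           = z<s
product-pos (x>0 ∷ xs>0) = *-pos x>0 (product-pos xs>0)
  where
  *-pos : ∀ {m n} → 0 < m → 0 < n → 0 < m * n
  *-pos {suc m} {suc n} _ _ = z<s

coprime-* : ∀ {a b c} → Coprime a b → Coprime a c → Coprime a (b * c)
coprime-* cab cac (d∣a , d∣bc) = cac (d∣a , coprime-divisor (λ (e∣d , e∣b) → cab (∣-trans e∣d d∣a , e∣b)) d∣bc)

coprime-product : ∀ {n x} {ys : Vec ℕ n} → All (Coprime x) ys → Coprime x (product ys)
coprime-product []       (_ , d∣1) = ∣1⇒≡1 d∣1
coprime-product (c ∷ cs)          = coprime-* c (coprime-product cs)

coprime-∣⇒*∣ : ∀ {m n t} → Coprime m n → m ∣ t → n ∣ t → m * n ∣ t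
coprime-∣⇒*∣ {m} {n} c (divides q refl) n∣qm with coprime-divisor (Coprime.sym c) (subst (n ∣_) (*-comm q m) n∣qm)
... | divides r refl = divides r (trans (*-assoc r n m) (cong (r *_) (*-comm n m)))

-- In the case 1 + x n ≡ y m of Bézout's identity, (m ∸ 1) x + m is an inverse of n modulo m.
coprime⇒inverse : ∀ {m n} → 0 < m → 0 < n → Coprime n m → ∃₂ λ x y → x * n ≡ 1 + y * m
coprime⇒inverse {suc a} {suc l} _ _ c with coprime-Bézout c
... | Bézout.+- x y eq = x , y , sym eq
... | Bézout.-+ x y eq = x * a + suc a , y * a + l , +-cancelˡ-≡ a _ _ (begin
  a + (x * a + suc a) * suc l         ≡⟨ expand x a l ⟩
  a * (1 + x * suc l) + suc a * suc l  ≡⟨ cong (λ z → a * z + suc a * suc l) eq ⟩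
  a * (y * suc a) + suc a * suc l      ≡⟨ collect y a l ⟩
  a + (1 + (y * a + l) * suc a)        ∎)
  where
  open ≡-Reasoning
  expand : ∀ x a l → a + (x * a + suc a) * suc l ≡ a * (1 + x * suc l) + suc a * suc l
  expand = solve-∀
  collect : ∀ y a l → a * (y * suc a) + suc a * suc l ≡ a + (1 + (y * a + l) * suc a)
  collect = solve-∀

even-coprime⇒odd : ∀ {x y} → parity x ≡ 0ℙ → Coprime x y → parity y ≡ 1ℙ
even-coprime⇒odd {y = y} x-even cop with parity y in y-parity
... | 1ℙ = refl
... | 0ℙ with () ← cop (even⇒2∣ x-even , even⇒2∣ y-parity)

∣-cancel-multiple : ∀ {M} x q w → M ∣ (x + q * M) + w → M ∣ w + x
∣-cancel-multiple {M} x q w M∣ = ∣m+n∣m⇒∣n (subst (M ∣_) (regroup x q w M) M∣) (n∣m*n q)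
  where
  regroup : ∀ x q w M → x + q * M + w ≡ q * M + (w + x)
  regroup = solve-∀

-- One coordinate of the billiard

onBoundary : ℕ → ℕ → Bool
onBoundary a x = (x ≡ᵇ 0) ∨ (x ≡ᵇ a)

coordState : ℕ → ℕ → ℕ × Bool
coordState a zero    = 0 , true
coordState a (suc t) = stepCoord a (coordState a t)

coordPos : ℕ → ℕ → ℕ
coordPos a t = proj₁ (coordState a t)

coordState-rising : ∀ {A} d → d < A → coordState A d ≡ (d , true)
coordState-rising zero    _   = refl
coordState-rising {A} (suc d) d<A rewrite coordState-rising d (<⇒≤ d<A) =
  cong (λ b → suc d , not b) (dec-false (suc d ≟ A) (<⇒≢ d<A))

coordState-turn : ∀ d → coordState (suc d) (suc d) ≡ (suc d , false)
coordState-turn d rewrite coordState-rising d (n<1+n d) =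
  cong (λ b → suc d , not b) (dec-true (d ≟ d) refl)

coordState-falling : ∀ {A} d e → d + suc e ≡ A → coordState A (A + d) ≡ (suc e , false)
coordState-falling zero e refl rewrite +-identityʳ e = coordState-turn e
coordState-falling {A} (suc d) e eq rewrite +-suc A d
  | coordState-falling d (suc e) (trans (+-suc d (suc e)) eq) = refl

coordState-period : ∀ a → coordState (suc a) (2 * suc a) ≡ (0 , true)
coordState-period a rewrite +-identityʳ a | +-suc a a
  | coordState-falling a 0 (+-comm a 1) = refl

coordState-+-period : ∀ {A p} → coordState A p ≡ coordState A 0 → ∀ t → coordState A (t + p) ≡ coordState A t
coordState-+-period p-period zero    = p-period
coordState-+-period p-period (suc t) = cong (stepCoord _) (coordState-+-period p-period t)

coordState-periodic : ∀ {A d} → 0 < A → 2 * A ∣ d → ∀ t → coordState A (t + d) ≡ coordState A t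
coordState-periodic {suc a} _ (divides q refl) = coordState-+-period (multiple q)
  where
  multiple : ∀ q → coordState (suc a) (q * (2 * suc a)) ≡ (0 , true)
  multiple zero    = refl
  multiple (suc q) = begin
    coordState (suc a) (2 * suc a + q * (2 * suc a)) ≡⟨ cong (coordState (suc a)) (+-comm (2 * suc a) _) ⟩
    coordState (suc a) (q * (2 * suc a) + 2 * suc a) ≡⟨ coordState-+-period (coordState-period a) (q * (2 * suc a)) ⟩
    coordState (suc a) (q * (2 * suc a))             ≡⟨ multiple q ⟩
    (0 , true)                                       ∎
    where open ≡-Reasoning

coordPos-periodic : ∀ {A d} → 0 < A → 2 * A ∣ d → ∀ t → coordPos A (t + d) ≡ coordPos A t
coordPos-periodic A>0 2A∣d t = cong proj₁ (coordState-periodic A>0 2A∣d t)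

-- In the rising phase the coordinate is at d, in the falling phase at suc e = A ∸ d.
data Phase (A t : ℕ) : Set where
  rising  : ∀ d q → d < A → t ≡ d + q * (2 * A) → Phase A t
  falling : ∀ d e q → d + suc e ≡ A → t ≡ (A + d) + q * (2 * A) → Phase A t

phase : ∀ {A} → 0 < A → ∀ t → Phase A t
phase {A@(suc _)} _ t = classify (t % (2 * A)) (m%n<n t (2 * A)) (m≡m%n+[m/n]*n t (2 * A))
  where
  classify : ∀ r → r < 2 * A → t ≡ r + (t / (2 * A)) * (2 * A) → Phase A t
  classify r r<2A t≡ with r <? A
  ... | yes r<A = rising r (t / (2 * A)) r<A t≡
  ... | no  r≮A with m≤n⇒∃[o]m+o≡n (≮⇒≥ r≮A)
  ...   | d , refl with m≤n⇒∃[o]m+o≡n (+-cancelˡ-< A d A (subst (A + d <_) (cong (A +_) (+-identityʳ A)) r<2A))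
  ...     | e , 1+d+e≡A = falling d e (t / (2 * A)) (trans (+-suc d e) 1+d+e≡A) t≡

coordPos-rising : ∀ {A} d q → 0 < A → d ≤ A → coordPos A (d + q * (2 * A)) ≡ d
coordPos-rising {A} d q A>0 d≤A rewrite coordPos-periodic A>0 (n∣m*n q) d with m≤n⇒m<n∨m≡n d≤A
... | inj₁ d<A  = cong proj₁ (coordState-rising d d<A)
... | inj₂ refl with A>0
...   | s≤s _ = cong proj₁ (coordState-turn _)

coordPos-falling : ∀ {A} d e q → d + suc e ≡ A → coordPos A ((A + d) + q * (2 * A)) ≡ suc e
coordPos-falling {A} d e q eq =
  trans (coordPos-periodic A>0 (n∣m*n q) (A + d)) (cong proj₁ (coordState-falling d e eq))
  where
  A>0 : 0 < A
  A>0 = subst (0 <_) eq (≤-trans (s≤s z≤n) (m≤n+m (suc e) d))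

coordPos-parity : ∀ {A} → 0 < A → ∀ t → parity (coordPos A t) ≡ parity t
coordPos-parity {A} A>0 t with phase A>0 t
... | rising d q d<A refl = begin
  parity (coordPos A (d + q * (2 * A))) ≡⟨ cong parity (coordPos-rising d q A>0 (<⇒≤ d<A)) ⟩
  parity d                              ≡⟨ parity-+-even d (∣n⇒∣m*n q (m∣m*n A)) ⟨
  parity (d + q * (2 * A))              ∎
  where open ≡-Reasoning
... | falling d e q refl refl = begin
  parity (coordPos A (A + d + q * (2 * A))) ≡⟨ cong parity (coordPos-falling d e q refl) ⟩
  parity (suc e)                            ≡⟨ parity-+-even (suc e) (m∣m*n (d + q * A)) ⟨
  parity (suc e + 2 * (d + q * A))          ≡⟨ cong parity (rearrange d e q) ⟩
  parity (A + d + q * (2 * A))              ∎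
  where
  open ≡-Reasoning
  rearrange : ∀ d e q → suc e + 2 * (d + q * (d + suc e)) ≡ (d + suc e) + d + q * (2 * (d + suc e))
  rearrange = solve-∀

T-onBoundary : ∀ {a x} → T (onBoundary a x) → x ≡ 0 ⊎ x ≡ a
T-onBoundary {a} {x} h = Sum.map (≡ᵇ⇒≡ x 0) (≡ᵇ⇒≡ x a) (Equivalence.to T-∨ h)

coordPos-onBoundary⇒∣ : ∀ {A} → 0 < A → ∀ t → T (onBoundary A (coordPos A t)) → A ∣ t
coordPos-onBoundary⇒∣ {A} A>0 t onB with phase A>0 t
... | rising d q d<A refl with T-onBoundary {A} {d} (subst (T ∘ onBoundary A) (coordPos-rising d q A>0 (<⇒≤ d<A)) onB)
...   | inj₁ refl = ∣n⇒∣m*n q (n∣m*n 2)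
...   | inj₂ refl = contradiction d<A (<-irrefl refl)
coordPos-onBoundary⇒∣ {A} A>0 t onB | falling d e q eq refl
  with T-onBoundary {A} {suc e} (subst (T ∘ onBoundary A) (coordPos-falling d e q eq) onB)
...   | inj₂ 1+e≡A = ∣m∣n⇒∣m+n (∣m∣n⇒∣m+n ∣-refl (subst (A ∣_) (sym d≡0) (A ∣0))) (∣n⇒∣m*n q (n∣m*n 2))
  where
  d≡0 : d ≡ 0
  d≡0 = +-cancelʳ-≡ (suc e) d 0 (trans eq (sym 1+e≡A))

coordPos-reflected : ∀ {A} w v q → 0 < A → v ≤ A → w + v ≡ q * (2 * A) → coordPos A w ≡ v
coordPos-reflected w zero q A>0 _ eq =
  trans (cong (coordPos _) (trans (sym (+-identityʳ w)) eq)) (coordPos-rising 0 q A>0 z≤n)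
coordPos-reflected w (suc e) zero A>0 _ eq = contradiction eq (m+1+n≢0 w)
coordPos-reflected w (suc e) (suc q) A>0 1+e≤A eq with m≤n⇒∃[o]m+o≡n 1+e≤A
... | d , refl = trans (cong (coordPos _) w≡) (coordPos-falling d e q (+-comm d (suc e)))
  where
  unfold : ∀ d e q → suc q * (2 * (suc e + d)) ≡ ((suc e + d) + d + q * (2 * (suc e + d))) + suc e
  unfold = solve-∀
  w≡ : w ≡ (suc e + d + d) + q * (2 * (suc e + d))
  w≡ = +-cancelʳ-≡ (suc e) w _ (trans eq (unfold d e q))

coordPos-symmetric : ∀ {A} u w → 0 < A → 2 * A ∣ u + w → coordPos A w ≡ coordPos A u
coordPos-symmetric {A} u w A>0 2A∣u+w with phase A>0 u
... | rising d q d<A refl with ∣-cancel-multiple d q w 2A∣u+w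
...   | divides k eq = trans (coordPos-reflected w d k A>0 (<⇒≤ d<A) eq) (sym (coordPos-rising d q A>0 (<⇒≤ d<A)))
coordPos-symmetric {A} u w A>0 2A∣u+w | falling d e q refl refl with ∣-cancel-multiple (A + d) q w 2A∣u+w
...   | divides zero eq = contradiction eq (m<n⇒n≢0 (<-≤-trans A>0 (≤-trans (m≤m+n A d) (m≤n+m (A + d) w))))
...   | divides (suc k) eq = begin
  coordPos A w                        ≡⟨ cong (coordPos A) w≡ ⟩
  coordPos A (suc e + k * (2 * A))    ≡⟨ coordPos-rising (suc e) k A>0 (m≤n+m (suc e) d) ⟩
  suc e                               ≡⟨ coordPos-falling d e q refl ⟨
  coordPos A (A + d + q * (2 * A))    ∎
  where
  open ≡-Reasoning
  unfold : ∀ d e k → suc k * (2 * (d + suc e)) ≡ (suc e + k * (2 * (d + suc e))) + ((d + suc e) + d)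
  unfold = solve-∀
  w≡ : w ≡ suc e + k * (2 * A)
  w≡ = +-cancelʳ-≡ (A + d) w _ (trans eq (unfold d e k))

-- The trajectory

coordPositions : ∀ {n} → Vec ℕ n → ℕ → Vec ℕ n
coordPositions a t = V.map (λ x → coordPos x t) a

posAt≡coordPositions : ∀ {n} (a : Vec ℕ n) t → posAt a t ≡ coordPositions a t
posAt≡coordPositions a t = trans (cong (V.map proj₁) (stateAt≡ a t)) (sym (V.map-∘ proj₁ (λ x → coordState x t) a))
  where
  stateAt≡ : ∀ {n} (a : Vec ℕ n) t → stateAt a t ≡ V.map (λ x → coordState x t) a
  stateAt≡ a zero    = sym (V.map-const a (0 , true))
  stateAt≡ a (suc t) = trans (cong (V.zipWith stepCoord a) (stateAt≡ a t)) (zipWith-map a)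
    where
    zipWith-map : ∀ {n} (a : Vec ℕ n) →
                  V.zipWith stepCoord a (V.map (λ x → coordState x t) a) ≡ V.map (λ x → coordState x (suc t)) a
    zipWith-map []      = refl
    zipWith-map (x ∷ a) = cong (_ ∷_) (zipWith-map a)

coordPositions-parity : ∀ {n} {a : Vec ℕ n} → All (0 <_) a → ∀ t → All (λ y → parity y ≡ parity t) (coordPositions a t)
coordPositions-parity []           t = []
coordPositions-parity (x>0 ∷ xs>0) t = coordPos-parity x>0 t ∷ coordPositions-parity xs>0 t

corner⇒product∣ : ∀ {n} {a : Vec ℕ n} → All (0 <_) a → AllPairs Coprime a →
                  ∀ t → T (isCorner a (coordPositions a t)) → product a ∣ t
corner⇒product∣ []           []           t _ = 1∣ t
corner⇒product∣ (x>0 ∷ xs>0) (c ∷ cs) t corner with Equivalence.to T-∧ corner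
... | onB , rest = coprime-∣⇒*∣ (coprime-product c) (coordPos-onBoundary⇒∣ x>0 t onB) (corner⇒product∣ xs>0 cs t rest)

coordPositions-periodic : ∀ {n} {a : Vec ℕ n} {d} → All (0 <_) a → 2 * product a ∣ d →
                          ∀ t → coordPositions a (t + d) ≡ coordPositions a t
coordPositions-periodic [] _ t = refl
coordPositions-periodic {a = x ∷ xs} (x>0 ∷ xs>0) 2P∣d t = cong₂ _∷_
  (coordPos-periodic x>0 (∣-trans (*-monoʳ-∣ 2 (m∣m*n {x} (product xs))) 2P∣d) t)
  (coordPositions-periodic xs>0 (∣-trans (*-monoʳ-∣ 2 (n∣m*n x {product xs})) 2P∣d) t)

coordPositions-symmetric : ∀ {n} {a : Vec ℕ n} → All (0 <_) a →
                           ∀ u w → 2 * product a ∣ u + w → coordPositions a w ≡ coordPositions a u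
coordPositions-symmetric [] u w _ = refl
coordPositions-symmetric {a = x ∷ xs} (x>0 ∷ xs>0) u w 2P∣u+w = cong₂ _∷_
  (coordPos-symmetric u w x>0 (∣-trans (*-monoʳ-∣ 2 (m∣m*n {x} (product xs))) 2P∣u+w))
  (coordPositions-symmetric xs>0 u w (∣-trans (*-monoʳ-∣ 2 (n∣m*n x {product xs})) 2P∣u+w))

-- The Chinese remainder theorem for the moduli 2aᵢ, whose pairwise gcd is 2: a solution t′ for
-- the tail is corrected by a multiple of 2L, L the product of the tail, chosen with an inverse
-- of L modulo A. This needs t′ ≡ v (mod 2), which is why the parity of t is part of the claim.
sameParity⇒reached : ∀ {n} {a v : Vec ℕ n} p → All (0 <_) a → AllPairs Coprime a → Pointwise _≤_ v a →
                     All (λ y → parity y ≡ p) v → ∃[ t ] parity t ≡ p × coordPositions a t ≡ v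
sameParity⇒reached 0ℙ [] [] [] [] = 0 , refl , refl
sameParity⇒reached 1ℙ [] [] [] [] = 1 , refl , refl
sameParity⇒reached {a = A ∷ as} {v ∷ vs} p (A>0 ∷ as>0) (c ∷ cs) (v≤A ∷ vs≤as) (pv ∷ pvs)
  with sameParity⇒reached p as>0 cs vs≤as pvs
     | coprime⇒inverse A>0 (product-pos as>0) (Coprime.sym (coprime-product c))
... | t′ , pt′ , t′↦vs | L⁻¹ , m , L⁻¹L≡1+mA
  with parity-≡⇒∃[d]n≡m+d*2 {t′} {v + t′ * (2 * A)} (trans pt′ (sym (trans (parity-+-even v 2∣2At′) pv))) t′≤v+2At′
  where
  2∣2At′ : 2 ∣ t′ * (2 * A)
  2∣2At′ = ∣n⇒∣m*n t′ (m∣m*n A)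
  t′≤v+2At′ : t′ ≤ v + t′ * (2 * A)
  t′≤v+2At′ = ≤-trans (m≤m*n t′ (2 * A) {{>-nonZero (<-≤-trans A>0 (m≤m+n A (A + 0)))}}) (m≤n+m _ v)
... | c′ , gap = t , pt , cong₂ _∷_ t↦v (trans (coordPositions-periodic as>0 2L∣Δt t′) t′↦vs)
  where
  L = product as
  Δt = L⁻¹ * c′ * (2 * L)
  t = t′ + Δt
  2L∣Δt : 2 * L ∣ Δt
  2L∣Δt = n∣m*n (L⁻¹ * c′)
  pt : parity t ≡ p
  pt = trans (parity-+-even t′ (∣-trans (m∣m*n L) 2L∣Δt)) pt′
  t≡ : t ≡ v + (t′ + m * c′) * (2 * A)
  t≡ = begin
    t′ + L⁻¹ * c′ * (2 * L)               ≡⟨ regroup₁ t′ L⁻¹ c′ L ⟩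
    t′ + c′ * 2 * (L⁻¹ * L)               ≡⟨ cong (λ z → t′ + c′ * 2 * z) L⁻¹L≡1+mA ⟩
    t′ + c′ * 2 * (1 + m * A)             ≡⟨ regroup₂ t′ c′ m A ⟩
    (t′ + c′ * 2) + m * c′ * (2 * A)      ≡⟨ cong (_+ m * c′ * (2 * A)) gap ⟨
    (v + t′ * (2 * A)) + m * c′ * (2 * A) ≡⟨ regroup₃ v t′ m c′ A ⟩
    v + (t′ + m * c′) * (2 * A)           ∎
    where
    open ≡-Reasoning
    regroup₁ : ∀ t′ x c L → t′ + x * c * (2 * L) ≡ t′ + c * 2 * (x * L)
    regroup₁ = solve-∀
    regroup₂ : ∀ t′ c m A → t′ + c * 2 * (1 + m * A) ≡ (t′ + c * 2) + m * c * (2 * A)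
    regroup₂ = solve-∀
    regroup₃ : ∀ v t′ m c A → (v + t′ * (2 * A)) + m * c * (2 * A) ≡ v + (t′ + m * c) * (2 * A)
    regroup₃ = solve-∀
  t↦v : coordPos A t ≡ v
  t↦v = trans (cong (coordPos A) t≡) (coordPos-rising v (t′ + m * c′) A>0 v≤A)

coordPositions-fold : ∀ {n} {a : Vec ℕ n} → All (0 <_) a →
                      ∀ t → ∃[ s ] s ≤ product a × coordPositions a s ≡ coordPositions a t
coordPositions-fold {a = a} a>0 t = fold (t % (2 * P)) (m%n<n t (2 * P)) t↦r
  where
  P = product a
  instance
    2P≢0 : NonZero (2 * P)
    2P≢0 = >-nonZero (<-≤-trans (product-pos a>0) (m≤m+n P (P + 0)))
  t↦r : coordPositions a t ≡ coordPositions a (t % (2 * P))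
  t↦r = trans (cong (coordPositions a) (m≡m%n+[m/n]*n t (2 * P))) (coordPositions-periodic a>0 (n∣m*n (t / (2 * P))) (t % (2 * P)))
  fold : ∀ r → r < 2 * P → coordPositions a t ≡ coordPositions a r → ∃[ s ] s ≤ P × coordPositions a s ≡ coordPositions a t
  fold r r<2P t↦r with r ≤? P
  ... | yes r≤P = r , r≤P , sym t↦r
  ... | no  r≰P with m≤n⇒∃[o]m+o≡n (<⇒≤ r<2P)
  ...   | o , r+o≡2P = o , o≤P , trans (coordPositions-symmetric a>0 r o (subst (2 * P ∣_) (sym r+o≡2P) ∣-refl)) (sym t↦r)
    where
    o≤P : o ≤ P
    o≤P = +-cancelˡ-≤ P o P (≤-trans (+-monoˡ-≤ o (<⇒≤ (≰⇒> r≰P)))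
                                     (≤-reflexive (trans r+o≡2P (cong (P +_) (+-identityʳ P)))))

firstCornerFrom-≥ : ∀ {n} (a : Vec ℕ n) {P} fuel t → (∀ s → t ≤ s → s < P → ¬ T (isCorner a (posAt a s))) →
                    P ≤ t + fuel → P ≤ firstCornerFrom a fuel t
firstCornerFrom-≥ a {P} zero t _ P≤t+0 = subst (P ≤_) (+-identityʳ t) P≤t+0
firstCornerFrom-≥ a {P} (suc fuel) t noCorner P≤t+1+fuel with isCorner a (posAt a t) in corner
... | true with P ≤? t
...   | yes P≤t = P≤t
...   | no  P≰t = contradiction (subst T (sym corner) _) (noCorner t ≤-refl (≰⇒> P≰t))
firstCornerFrom-≥ a {P} (suc fuel) t noCorner P≤t+1+fuel | false =
  firstCornerFrom-≥ a fuel (suc t) (λ s t<s → noCorner s (<⇒≤ t<s)) (subst (P ≤_) (+-suc t fuel) P≤t+1+fuel)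

product≤trajLength : ∀ {n} {a : Vec ℕ n} → All (0 <_) a → AllPairs Coprime a → product a ≤ trajLength a
product≤trajLength {a = a} a>0 cop = firstCornerFrom-≥ a _ 1 noCorner (m≤n⇒m≤1+n (product≤fuel a))
  where
  noCorner : ∀ s → 1 ≤ s → s < product a → ¬ T (isCorner a (posAt a s))
  noCorner (suc s) _ s<P corner =
    <⇒≱ s<P (∣⇒≤ (corner⇒product∣ a>0 cop (suc s) (subst (T ∘ isCorner a) (posAt≡coordPositions a (suc s)) corner)))
  product≤fuel : ∀ {n} (a : Vec ℕ n) → product a ≤ V.foldr _ (λ x r → 2 * x * r) 1 a
  product≤fuel []      = ≤-refl
  product≤fuel (x ∷ a) = *-mono-≤ (m≤n*m x 2) (product≤fuel a)

count : (X → Bool) → List X → ℕ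
count p xs = length (filterᵇ p xs)

count>0⇒∃ : ∀ {p : X → Bool} xs → 0 < count p xs → ∃[ x ] x ∈ xs × T (p x)
count>0⇒∃ {p = p} (x ∷ xs) c>0 with p x in px
... | true  = x , here refl , subst T (sym px) tt
... | false = Product.map₂ (Product.map₁ there) (count>0⇒∃ xs c>0)

∈⇒count>0 : ∀ {p : X → Bool} {x xs} → x ∈ xs → T (p x) → 0 < count p xs
∈⇒count>0 {p = p} x∈xs px = filter-some (T? ∘ p) (lose x∈xs px)

filterᵇ-map : ∀ (p : Y → Bool) (f : X → Y) xs → filterᵇ p (map f xs) ≡ map f (filterᵇ (p ∘ f) xs)
filterᵇ-map p f []       = refl
filterᵇ-map p f (x ∷ xs) with p (f x)
... | true  = cong (f x ∷_) (filterᵇ-map p f xs)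
... | false = filterᵇ-map p f xs

count-map : ∀ (p : Y → Bool) (f : X → Y) xs → count p (map f xs) ≡ count (p ∘ f) xs
count-map p f xs = trans (cong length (filterᵇ-map p f xs)) (length-map f (filterᵇ (p ∘ f) xs))

count-++ : ∀ (p : X → Bool) xs ys → count p (xs ++ ys) ≡ count p xs + count p ys
count-++ p xs ys = trans (cong length (filter-++ (T? ∘ p) xs ys)) (length-++ (filterᵇ p xs))

count-concatMap : ∀ (p : Y → Bool) (f : X → List Y) xs → count p (concatMap f xs) ≡ sum (map (count p ∘ f) xs)
count-concatMap p f []       = refl
count-concatMap p f (x ∷ xs) = trans (count-++ p (f x) _) (cong (count p (f x) +_) (count-concatMap p f xs))

count-none : ∀ {p : X → Bool} xs → (∀ x → p x ≡ false) → count p xs ≡ 0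
count-none []       _ = refl
count-none {p = p} (x ∷ xs) ¬p rewrite ¬p x = count-none xs ¬p

count-cong : ∀ {p q : X → Bool} xs → (∀ {x} → x ∈ xs → p x ≡ q x) → count p xs ≡ count q xs
count-cong []       _   = refl
count-cong {p = p} {q} (x ∷ xs) p≡q rewrite p≡q (here refl) with q x
... | true  = cong suc (count-cong xs (p≡q ∘ there))
... | false = count-cong xs (p≡q ∘ there)

count-∨ : ∀ (p q : X → Bool) xs → (∀ x → T (p x) → T (q x) → ⊥) →
          count (λ x → p x ∨ q x) xs ≡ count p xs + count q xs
count-∨ p q []       _        = refl
count-∨ p q (x ∷ xs) disjoint with p x in px | q x in qx
... | true  | true  = ⊥-elim (disjoint x (subst T (sym px) _) (subst T (sym qx) _))
... | true  | false = cong suc (count-∨ p q xs disjoint)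
... | false | true  = trans (cong suc (count-∨ p q xs disjoint)) (sym (+-suc _ _))
... | false | false = count-∨ p q xs disjoint

sum-applyUpTo-cong : ∀ {f g : ℕ → ℕ} m → (∀ {y} → y < m → f y ≡ g y) → sum (applyUpTo f m) ≡ sum (applyUpTo g m)
sum-applyUpTo-cong zero    _   = refl
sum-applyUpTo-cong (suc m) f≡g = cong₂ _+_ (f≡g z<s) (sum-applyUpTo-cong m (f≡g ∘ s<s))

sum-applyUpTo-∷ʳ : ∀ (f : ℕ → ℕ) m → sum (applyUpTo f (suc m)) ≡ sum (applyUpTo f m) + f m
sum-applyUpTo-∷ʳ f m = begin
  sum (applyUpTo f (suc m))               ≡⟨ cong sum (applyUpTo-∷ʳ f m) ⟨
  sum (applyUpTo f m ∷ʳ f m)              ≡⟨ sum-++ (applyUpTo f m) (f m ∷ []) ⟩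
  sum (applyUpTo f m) + (f m + 0)         ≡⟨ cong (sum (applyUpTo f m) +_) (+-identityʳ (f m)) ⟩
  sum (applyUpTo f m) + f m               ∎
  where open ≡-Reasoning

sum-applyUpTo-periodic : ∀ (f : ℕ → ℕ) → (∀ y → f (2 + y) ≡ f y) → ∀ j → sum (applyUpTo f (j * 2)) ≡ j * (f 0 + f 1)
sum-applyUpTo-periodic f periodic zero    = refl
sum-applyUpTo-periodic f periodic (suc j) = begin
  f 0 + (f 1 + sum (applyUpTo (λ y → f (2 + y)) (j * 2))) ≡⟨ cong (λ z → f 0 + (f 1 + z)) shifted ⟩
  f 0 + (f 1 + j * (f 0 + f 1))                           ≡⟨ +-assoc (f 0) (f 1) _ ⟨
  suc j * (f 0 + f 1)                                     ∎
  where
  open ≡-Reasoning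
  shifted : sum (applyUpTo (λ y → f (2 + y)) (j * 2)) ≡ j * (f 0 + f 1)
  shifted = trans (sum-applyUpTo-cong (j * 2) (λ _ → periodic _)) (sum-applyUpTo-periodic f periodic j)

sum-map-filterᵇ-++ : ∀ (f : X → ℕ) (p : X → Bool) xs ys →
                     sum (map f (filterᵇ p (xs ++ ys))) ≡ sum (map f (filterᵇ p xs)) + sum (map f (filterᵇ p ys))
sum-map-filterᵇ-++ f p xs ys = trans (cong (sum ∘ map f) (filter-++ (T? ∘ p) xs ys))
  (trans (cong sum (map-++ f (filterᵇ p xs) (filterᵇ p ys))) (sum-++ (map f (filterᵇ p xs)) _))

sum-map-filterᵇ-map : ∀ (f : Y → ℕ) (p : Y → Bool) (g : X → Y) xs →
                      sum (map f (filterᵇ p (map g xs))) ≡ sum (map (f ∘ g) (filterᵇ (p ∘ g) xs))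
sum-map-filterᵇ-map f p g xs = cong sum (trans (cong (map f) (filterᵇ-map p g xs)) (sym (map-∘ (filterᵇ (p ∘ g) xs))))

sum-map-*ˡ : ∀ c (f : X → ℕ) xs → sum (map (λ x → c * f x) xs) ≡ c * sum (map f xs)
sum-map-*ˡ c f []       = sym (*-zeroʳ c)
sum-map-*ˡ c f (x ∷ xs) = trans (cong (c * f x +_) (sum-map-*ˡ c f xs)) (sym (*-distribˡ-+ c (f x) _))

-- Crossing numbers

vecEqᵇ⇒≡ : ∀ {n} (u v : Vec ℕ n) → T (vecEqᵇ u v) → u ≡ v
vecEqᵇ⇒≡ []       []       _  = refl
vecEqᵇ⇒≡ (x ∷ u) (y ∷ v) eq with Equivalence.to T-∧ eq
... | x≡y , u≡v = cong₂ _∷_ (≡ᵇ⇒≡ x y x≡y) (vecEqᵇ⇒≡ u v u≡v)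

vecEqᵇ-refl : ∀ {n} (v : Vec ℕ n) → T (vecEqᵇ v v)
vecEqᵇ-refl []      = tt
vecEqᵇ-refl (x ∷ v) = Equivalence.from T-∧ (≡⇒≡ᵇ x x refl , vecEqᵇ-refl v)

crossingNumber>0⇒reached : ∀ {n} (a v : Vec ℕ n) → 0 < crossingNumber a v → ∃[ t ] posAt a t ≡ v
crossingNumber>0⇒reached a v c>0 with count>0⇒∃ (upTo (suc (trajLength a))) c>0
... | t , _ , t↦v = t , vecEqᵇ⇒≡ _ _ t↦v

reached⇒crossingNumber>0 : ∀ {n} (a v : Vec ℕ n) t → t ≤ trajLength a → posAt a t ≡ v → 0 < crossingNumber a v
reached⇒crossingNumber>0 a v t t≤L refl =
  ∈⇒count>0 {p = λ s → vecEqᵇ (posAt a s) (posAt a t)} (∈-upTo⁺ (s≤s t≤L)) (vecEqᵇ-refl (posAt a t))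

∈-boxPoints⁻ : ∀ {n} (a : Vec ℕ n) {v} → v ∈ boxPoints a → Pointwise _≤_ v a
∈-boxPoints⁻ []      (here refl) = []
∈-boxPoints⁻ (x ∷ a) v∈box with find (∈-concatMap⁻ (λ y → map (y ∷_) (boxPoints a)) {xs = upTo (suc x)} v∈box)
... | y , y∈ , v∈column with ∈-map⁻ (y ∷_) v∈column
...   | w , w∈box , refl = ≤-pred (∈-upTo⁻ y∈) ∷ ∈-boxPoints⁻ a w∈box

sameParity⇒crossingNumber>0 : ∀ {n} {a v : Vec ℕ n} p → All (0 <_) a → AllPairs Coprime a → Pointwise _≤_ v a →
                              All (λ y → parity y ≡ p) v → 0 < crossingNumber a v
sameParity⇒crossingNumber>0 {a = a} {v} p a>0 cop v≤a v≡p with sameParity⇒reached p a>0 cop v≤a v≡p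
... | t , _ , t↦v with coordPositions-fold a>0 t
...   | s , s≤P , s~t = reached⇒crossingNumber>0 a v s (≤-trans s≤P (product≤trajLength a>0 cop))
                          (trans (posAt≡coordPositions a s) (trans s~t t↦v))

crossingNumber>0⇒sameParity : ∀ {n} {a v : Vec ℕ n} → All (0 <_) a → 0 < crossingNumber a v →
                              ∃[ p ] All (λ y → parity y ≡ p) v
crossingNumber>0⇒sameParity {a = a} {v} a>0 c>0 with crossingNumber>0⇒reached a v c>0
... | t , t↦v = parity t , subst (All (λ y → parity y ≡ parity t)) (trans (sym (posAt≡coordPositions a t)) t↦v)
                                 (coordPositions-parity a>0 t)

allHaveParity : ∀ {n} → Parity → Vec ℕ n → Bool
allHaveParity p []       = true
allHaveParity p (x ∷ xs) = hasParity p x ∧ allHaveParity p xs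

T-allHaveParity⁻ : ∀ {n} {p} (v : Vec ℕ n) → T (allHaveParity p v) → All (λ x → parity x ≡ p) v
T-allHaveParity⁻ []      _ = []
T-allHaveParity⁻ {p = p} (x ∷ v) h with parity x ℙ.≟ p
... | yes x≡p = x≡p ∷ T-allHaveParity⁻ v h

T-allHaveParity⁺ : ∀ {n} {p} {v : Vec ℕ n} → All (λ x → parity x ≡ p) v → T (allHaveParity p v)
T-allHaveParity⁺ []                     = tt
T-allHaveParity⁺ {p = p} (_∷_ {x} x≡p v≡p) rewrite dec-true (parity x ℙ.≟ p) x≡p = T-allHaveParity⁺ v≡p

T-⇔⇒≡ : ∀ {x y} → (T x → T y) → (T y → T x) → x ≡ y
T-⇔⇒≡ {false} {false} _   _   = refl
T-⇔⇒≡ {false} {true}  _   y⇒x = ⊥-elim (y⇒x tt)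
T-⇔⇒≡ {true}  {false} x⇒y _   = ⊥-elim (x⇒y tt)
T-⇔⇒≡ {true}  {true}  _   _   = refl

crossed≡sameParity : ∀ {n} {a v : Vec ℕ n} → All (0 <_) a → AllPairs Coprime a → v ∈ boxPoints a →
                     not (crossingNumber a v ≡ᵇ 0) ≡ allHaveParity 0ℙ v ∨ allHaveParity 1ℙ v
crossed≡sameParity {a = a} {v} a>0 cop v∈box = T-⇔⇒≡ crossed⇒sameParity sameParity⇒crossed
  where
  T⇒>0 : ∀ c → T (not (c ≡ᵇ 0)) → 0 < c
  T⇒>0 (suc c) _ = z<s
  >0⇒T : ∀ {c} → 0 < c → T (not (c ≡ᵇ 0))
  >0⇒T z<s = tt
  crossed⇒sameParity : T (not (crossingNumber a v ≡ᵇ 0)) → T (allHaveParity 0ℙ v ∨ allHaveParity 1ℙ v)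
  crossed⇒sameParity crossed with crossingNumber>0⇒sameParity a>0 (T⇒>0 (crossingNumber a v) crossed)
  ... | 0ℙ , v≡0 = Equivalence.from T-∨ (inj₁ (T-allHaveParity⁺ v≡0))
  ... | 1ℙ , v≡1 = Equivalence.from T-∨ (inj₂ (T-allHaveParity⁺ v≡1))
  reach : T (allHaveParity 0ℙ v) ⊎ T (allHaveParity 1ℙ v) → 0 < crossingNumber a v
  reach (inj₁ v≡0) = sameParity⇒crossingNumber>0 0ℙ a>0 cop (∈-boxPoints⁻ a v∈box) (T-allHaveParity⁻ v v≡0)
  reach (inj₂ v≡1) = sameParity⇒crossingNumber>0 1ℙ a>0 cop (∈-boxPoints⁻ a v∈box) (T-allHaveParity⁻ v v≡1)
  sameParity⇒crossed : T (allHaveParity 0ℙ v ∨ allHaveParity 1ℙ v) → T (not (crossingNumber a v ≡ᵇ 0))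
  sameParity⇒crossed = >0⇒T ∘ reach ∘ Equivalence.to T-∨

-- Lattice points of one parity class

-- The coefficients of z · Σₖ f k zᵏ.
shift : (ℕ → ℕ) → ℕ → ℕ
shift f zero    = 0
shift f (suc k) = f k

shift-+ : ∀ (F G : ℕ → ℕ) k → shift F k + shift G k ≡ shift (λ i → F i + G i) k
shift-+ F G zero    = refl
shift-+ F G (suc k) = refl

sameParityCount : ∀ {n} → Vec ℕ n → Parity → ℕ → ℕ
sameParityCount a p k = count (λ v → (boundaryCount a v ≡ᵇ k) ∧ allHaveParity p v) (boxPoints a)

weight : Parity → ℕ → ℕ → ℕ → ℕ → ℕ
weight p a s c y = if hasParity p y then (if onBoundary a y then s else c) else 0

sameParityCount-∷ : ∀ {n} x (as : Vec ℕ n) p k →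
  sameParityCount (x ∷ as) p k ≡ sum (map (weight p x (shift (sameParityCount as p) k) (sameParityCount as p k)) (upTo (suc x)))
sameParityCount-∷ x as p k = trans (count-concatMap _ (λ y → map (y ∷_) (boxPoints as)) (upTo (suc x)))
  (cong sum (map-cong (λ y → trans (count-map _ (y ∷_) (boxPoints as)) (column (onBoundary x y) (hasParity p y) k)) (upTo (suc x))))
  where
  column : ∀ b h k → count (λ w → ((if b then 1 else 0) + boundaryCount as w ≡ᵇ k) ∧ (h ∧ allHaveParity p w)) (boxPoints as)
                     ≡ (if h then (if b then shift (sameParityCount as p) k else sameParityCount as p k) else 0)
  column b     false k       = count-none (boxPoints as) (λ w → ∧-zeroʳ _)
  column false true  k       = refl
  column true  true  zero    = count-none (boxPoints as) (λ w → refl)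
  column true  true  (suc k) = refl

sum-weight : ∀ p m s c → sum (map (weight p (suc m) s c) (upTo (2 + m)))
             ≡ (if hasParity p 0 then s else 0) + sum (applyUpTo (λ y → if hasParity p (suc y) then c else 0) m)
               + (if hasParity p (suc m) then s else 0)
sum-weight p m s c = begin
  w 0 + sum (map w (applyUpTo suc (suc m)))                      ≡⟨ cong (w 0 +_) (cong sum (map-applyUpTo suc w (suc m))) ⟩
  w 0 + sum (applyUpTo (w ∘ suc) (suc m))                        ≡⟨ cong (w 0 +_) (sum-applyUpTo-∷ʳ (w ∘ suc) m) ⟩
  w 0 + (sum (applyUpTo (w ∘ suc) m) + w (suc m))                ≡⟨ +-assoc (w 0) _ _ ⟨
  w 0 + sum (applyUpTo (w ∘ suc) m) + w (suc m)
    ≡⟨ cong₂ (λ x y → w 0 + x + y) (sum-applyUpTo-cong m interior) last ⟩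
  (if hasParity p 0 then s else 0) + sum (applyUpTo (λ y → if hasParity p (suc y) then c else 0) m)
    + (if hasParity p (suc m) then s else 0)                     ∎
  where
  open ≡-Reasoning
  w = weight p (suc m) s c
  interior : ∀ {y} → y < m → w (suc y) ≡ (if hasParity p (suc y) then c else 0)
  interior {y} y<m = cong (λ b → if hasParity p (suc y) then (if b then s else c) else 0) (dec-false (y ≟ m) (<⇒≢ y<m))
  last : w (suc m) ≡ (if hasParity p (suc m) then s else 0)
  last = cong (λ b → if hasParity p (suc m) then (if b then s else c) else 0) (dec-true (m ≟ m) refl)

sameParityCount-odd : ∀ {n} j (as : Vec ℕ n) p k →
  sameParityCount (1 + j * 2 ∷ as) p k ≡ j * sameParityCount as p k + shift (sameParityCount as p) k
sameParityCount-odd j as p k = begin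
  sameParityCount (1 + j * 2 ∷ as) p k                                      ≡⟨ sameParityCount-∷ (1 + j * 2) as p k ⟩
  sum (map (weight p (1 + j * 2) s c) (upTo (2 + j * 2)))                   ≡⟨ sum-weight p (j * 2) s c ⟩
  (if hasParity p 0 then s else 0) + sum (applyUpTo (λ y → if hasParity p (suc y) then c else 0) (j * 2))
    + (if hasParity p (1 + j * 2) then s else 0)
      ≡⟨ cong₂ (λ x y → (if hasParity p 0 then s else 0) + x + y) middle last ⟩
  (if hasParity p 0 then s else 0) + j * c + (if hasParity p 1 then s else 0) ≡⟨ ends p s (j * c) ⟩
  j * c + s                                                                 ∎
  where
  open ≡-Reasoning
  s = shift (sameParityCount as p) k
  c = sameParityCount as p k
  pair : ∀ p c → (if hasParity p 1 then c else 0) + (if hasParity p 2 then c else 0) ≡ c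
  pair 0ℙ c = refl
  pair 1ℙ c = +-identityʳ c
  middle : sum (applyUpTo (λ y → if hasParity p (suc y) then c else 0) (j * 2)) ≡ j * c
  middle = trans (sum-applyUpTo-periodic _ (λ _ → refl) j) (cong (j *_) (pair p c))
  last : (if hasParity p (1 + j * 2) then s else 0) ≡ (if hasParity p 1 then s else 0)
  last = cong (λ q → if does (q ℙ.≟ p) then s else 0) (parity[1+j*2] j)
  ends : ∀ p s x → (if hasParity p 0 then s else 0) + x + (if hasParity p 1 then s else 0) ≡ x + s
  ends 0ℙ s x = trans (+-identityʳ (s + x)) (+-comm s x)
  ends 1ℙ s x = refl

sameParityCount-even₀ : ∀ {n} j (as : Vec ℕ n) k →
  sameParityCount (2 + j * 2 ∷ as) 0ℙ k ≡ j * sameParityCount as 0ℙ k + 2 * shift (sameParityCount as 0ℙ) k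
sameParityCount-even₀ j as k = begin
  sameParityCount (2 + j * 2 ∷ as) 0ℙ k                                       ≡⟨ sameParityCount-∷ (2 + j * 2) as 0ℙ k ⟩
  sum (map (weight 0ℙ (2 + j * 2) s c) (upTo (3 + j * 2)))                    ≡⟨ sum-weight 0ℙ (1 + j * 2) s c ⟩
  s + sum (applyUpTo (λ y → if hasParity 0ℙ (suc y) then c else 0) (1 + j * 2))
    + (if hasParity 0ℙ (2 + j * 2) then s else 0)                             ≡⟨ cong₂ (λ x y → s + x + y) middle last ⟩
  s + j * c + s                                                               ≡⟨ rearrange s (j * c) ⟩
  j * c + 2 * s                                                               ∎
  where
  open ≡-Reasoning
  s = shift (sameParityCount as 0ℙ) k
  c = sameParityCount as 0ℙ k
  middle : sum (applyUpTo (λ y → if hasParity 0ℙ (suc y) then c else 0) (1 + j * 2)) ≡ j * c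
  middle = trans (sum-applyUpTo-periodic _ (λ _ → refl) j) (cong (j *_) (+-identityʳ c))
  last : (if hasParity 0ℙ (2 + j * 2) then s else 0) ≡ s
  last = cong (λ q → if does (q ℙ.≟ 0ℙ) then s else 0) (parity[j*2] j)
  rearrange : ∀ s x → s + x + s ≡ x + 2 * s
  rearrange = solve-∀

sameParityCount-even₁ : ∀ {n} j (as : Vec ℕ n) k →
  sameParityCount (2 + j * 2 ∷ as) 1ℙ k ≡ suc j * sameParityCount as 1ℙ k
sameParityCount-even₁ j as k = begin
  sameParityCount (2 + j * 2 ∷ as) 1ℙ k                                       ≡⟨ sameParityCount-∷ (2 + j * 2) as 1ℙ k ⟩
  sum (map (weight 1ℙ (2 + j * 2) s c) (upTo (3 + j * 2)))                    ≡⟨ sum-weight 1ℙ (1 + j * 2) s c ⟩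
  0 + sum (applyUpTo (λ y → if hasParity 1ℙ (suc y) then c else 0) (1 + j * 2))
    + (if hasParity 1ℙ (2 + j * 2) then s else 0)                             ≡⟨ cong₂ (λ x y → x + y) middle last ⟩
  suc j * c + 0                                                               ≡⟨ +-identityʳ (suc j * c) ⟩
  suc j * c                                                                   ∎
  where
  open ≡-Reasoning
  s = shift (sameParityCount as 1ℙ) k
  c = sameParityCount as 1ℙ k
  middle : sum (applyUpTo (λ y → if hasParity 1ℙ (suc y) then c else 0) (1 + j * 2)) ≡ suc j * c
  middle = cong (c +_) (sum-applyUpTo-periodic _ (λ _ → refl) j)
  last : (if hasParity 1ℙ (2 + j * 2) then s else 0) ≡ 0
  last = cong (λ q → if does (q ℙ.≟ 1ℙ) then s else 0) (parity[j*2] j)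

sameParityTotal : ∀ {n} → Vec ℕ n → ℕ → ℕ
sameParityTotal a k = sameParityCount a 0ℙ k + sameParityCount a 1ℙ k

sameParityTotal-odd : ∀ {n} j (as : Vec ℕ n) k →
  sameParityTotal (1 + j * 2 ∷ as) k ≡ j * sameParityTotal as k + shift (sameParityTotal as) k
sameParityTotal-odd j as k = begin
  sameParityTotal (1 + j * 2 ∷ as) k
    ≡⟨ cong₂ _+_ (sameParityCount-odd j as 0ℙ k) (sameParityCount-odd j as 1ℙ k) ⟩
  (j * C₀ k + shift C₀ k) + (j * C₁ k + shift C₁ k)
    ≡⟨ regroup j (C₀ k) (C₁ k) (shift C₀ k) (shift C₁ k) ⟩
  j * sameParityTotal as k + (shift C₀ k + shift C₁ k)
    ≡⟨ cong (j * sameParityTotal as k +_) (shift-+ C₀ C₁ k) ⟩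
  j * sameParityTotal as k + shift (sameParityTotal as) k ∎
  where
  open ≡-Reasoning
  C₀ = sameParityCount as 0ℙ
  C₁ = sameParityCount as 1ℙ
  regroup : ∀ j a b s t → (j * a + s) + (j * b + t) ≡ j * (a + b) + (s + t)
  regroup = solve-∀

-- For n = 0 the two parity classes would share the empty point.
bCount≡sameParityTotal : ∀ {n} {a : Vec ℕ (suc n)} → All (0 <_) a → AllPairs Coprime a →
                         ∀ k → bCount a k ≡ sameParityTotal a k
bCount≡sameParityTotal {a = a} a>0 cop k = trans (count-cong (boxPoints a) split) (count-∨ _ _ (boxPoints a) disjoint)
  where
  split : ∀ {v} → v ∈ boxPoints a → ((boundaryCount a v ≡ᵇ k) ∧ not (crossingNumber a v ≡ᵇ 0))
          ≡ ((boundaryCount a v ≡ᵇ k) ∧ allHaveParity 0ℙ v) ∨ ((boundaryCount a v ≡ᵇ k) ∧ allHaveParity 1ℙ v)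
  split {v} v∈box = trans (cong ((boundaryCount a v ≡ᵇ k) ∧_) (crossed≡sameParity a>0 cop v∈box))
                          (∧-distribˡ-∨ (boundaryCount a v ≡ᵇ k) (allHaveParity 0ℙ v) (allHaveParity 1ℙ v))
  disjoint : ∀ v → T ((boundaryCount a v ≡ᵇ k) ∧ allHaveParity 0ℙ v) →
                   T ((boundaryCount a v ≡ᵇ k) ∧ allHaveParity 1ℙ v) → ⊥
  disjoint v@(y ∷ _) v≡0 v≡1 = 0ℙ≢1ℙ (trans (sym (head {0ℙ} v≡0)) (head {1ℙ} v≡1))
    where
    0ℙ≢1ℙ : 0ℙ ≢ 1ℙ
    0ℙ≢1ℙ ()
    head : ∀ {p} → T ((boundaryCount a v ≡ᵇ k) ∧ allHaveParity p v) → parity y ≡ p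
    head h = All.head (T-allHaveParity⁻ v (proj₂ (Equivalence.to (T-∧ {boundaryCount a v ≡ᵇ k}) h)))

-- Generating functions

subsetSum-∷ : ∀ {n} x (as : Vec ℕ n) k → subsetSum (x ∷ as) k ≡ (x ∸ 1) * subsetSum as k + shift (subsetSum as) k
subsetSum-∷ {n} x as k = begin
  subsetSum (x ∷ as) k
    ≡⟨ sum-map-filterᵇ-++ (prodOutside (x ∷ as)) P (map (true ∷_) subsets) (map (false ∷_) subsets) ⟩
  sum (map (prodOutside (x ∷ as)) (filterᵇ P (map (true ∷_) subsets)))
    + sum (map (prodOutside (x ∷ as)) (filterᵇ P (map (false ∷_) subsets)))
    ≡⟨ cong₂ _+_ (sum-map-filterᵇ-map _ P (true ∷_) subsets) (sum-map-filterᵇ-map _ P (false ∷_) subsets) ⟩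
  sum (map (prodOutside as) (filterᵇ (λ J → suc ∣ J ∣ ≡ᵇ k) subsets))
    + sum (map (λ J → (x ∸ 1) * prodOutside as J) (filterᵇ (λ J → ∣ J ∣ ≡ᵇ k) subsets))
    ≡⟨ cong₂ _+_ (with-head k) (sum-map-*ˡ (x ∸ 1) (prodOutside as) (filterᵇ (λ J → ∣ J ∣ ≡ᵇ k) subsets)) ⟩
  shift (subsetSum as) k + (x ∸ 1) * subsetSum as k
    ≡⟨ +-comm (shift (subsetSum as) k) _ ⟩
  (x ∸ 1) * subsetSum as k + shift (subsetSum as) k ∎
  where
  open ≡-Reasoning
  subsets = allSubsets n
  P = λ (J : Subset (suc n)) → ∣ J ∣ ≡ᵇ k
  with-head : ∀ k → sum (map (prodOutside as) (filterᵇ (λ J → suc ∣ J ∣ ≡ᵇ k) subsets)) ≡ shift (subsetSum as) k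
  with-head zero    = cong sum (none subsets)
    where
    none : ∀ Js → map (prodOutside as) (filterᵇ (λ _ → false) Js) ≡ []
    none []       = refl
    none (_ ∷ Js) = none Js
  with-head (suc k) = refl

shift-scaled : ∀ m c (F G : ℕ → ℕ) → (∀ k → 2 ^ m * F k ≡ c * (2 ^ k * G k)) →
               ∀ k → 2 * (2 ^ m * shift F k) ≡ c * (2 ^ k * shift G k)
shift-scaled m c F G F≈G zero    = trans (cong (2 *_) (*-zeroʳ (2 ^ m))) (sym (*-zeroʳ c))
shift-scaled m c F G F≈G (suc k) = trans (cong (2 *_) (F≈G k)) (regroup c (2 ^ k) (G k))
  where
  regroup : ∀ c p g → 2 * (c * (p * g)) ≡ c * (2 * p * g)
  regroup = solve-∀

odd-step : ∀ {n} c j (as : Vec ℕ n) (F : ℕ → ℕ) → (∀ k → 2 ^ n * F k ≡ c * (2 ^ k * subsetSum as k)) →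
           ∀ k → 2 ^ suc n * (j * F k + shift F k) ≡ c * (2 ^ k * subsetSum (1 + j * 2 ∷ as) k)
odd-step {n} c j as F F≈S k = begin
  2 ^ suc n * (j * F k + shift F k)
    ≡⟨ distribute (2 ^ n) j (F k) (shift F k) ⟩
  j * 2 * (2 ^ n * F k) + 2 * (2 ^ n * shift F k)
    ≡⟨ cong₂ (λ x y → j * 2 * x + y) (F≈S k) (shift-scaled n c F S F≈S k) ⟩
  j * 2 * (c * (2 ^ k * S k)) + c * (2 ^ k * shift S k)
    ≡⟨ collect j c (2 ^ k) (S k) (shift S k) ⟩
  c * (2 ^ k * (j * 2 * S k + shift S k))
    ≡⟨ cong (λ z → c * (2 ^ k * z)) (subsetSum-∷ (1 + j * 2) as k) ⟨
  c * (2 ^ k * subsetSum (1 + j * 2 ∷ as) k) ∎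
  where
  open ≡-Reasoning
  S = subsetSum as
  distribute : ∀ p j f s → 2 * p * (j * f + s) ≡ j * 2 * (p * f) + 2 * (p * s)
  distribute = solve-∀
  collect : ∀ j c p g s → j * 2 * (c * (p * g)) + c * (p * s) ≡ c * (p * (j * 2 * g + s))
  collect = solve-∀

-- The factor 1 is the constant c of odd-step and shift-scaled.
allOdd⇒sameParityCount : ∀ {n} (as : Vec ℕ n) → All (λ x → parity x ≡ 1ℙ) as →
                         ∀ p k → 2 ^ n * sameParityCount as p k ≡ 1 * (2 ^ k * subsetSum as k)
allOdd⇒sameParityCount []       []                  p zero    = refl
allOdd⇒sameParityCount []       []                  p (suc k) = sym (trans (+-identityʳ _) (*-zeroʳ (2 ^ suc k)))
allOdd⇒sameParityCount {suc n} (x ∷ as) (x-odd ∷ as-odd) p k with odd⇒1+j*2 {x} x-odd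
... | j , refl = trans (cong (2 ^ suc n *_) (sameParityCount-odd j as p k))
                       (odd-step 1 j as _ (allOdd⇒sameParityCount as as-odd p) k)

allOdd⇒sameParityTotal-even∷ : ∀ {n} j (as : Vec ℕ n) → All (λ x → parity x ≡ 1ℙ) as →
  ∀ k → 2 ^ suc n * sameParityTotal (2 + j * 2 ∷ as) k ≡ 2 * (2 ^ k * subsetSum (2 + j * 2 ∷ as) k)
allOdd⇒sameParityTotal-even∷ {n} j as as-odd k = begin
  2 ^ suc n * sameParityTotal (2 + j * 2 ∷ as) k
    ≡⟨ cong (2 ^ suc n *_) (cong₂ _+_ (sameParityCount-even₀ j as k) (sameParityCount-even₁ j as k)) ⟩
  2 ^ suc n * ((j * C₀ k + 2 * shift C₀ k) + suc j * C₁ k)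
    ≡⟨ distribute (2 ^ n) j (C₀ k) (shift C₀ k) (C₁ k) ⟩
  j * 2 * (2 ^ n * C₀ k) + 2 * (2 * (2 ^ n * shift C₀ k)) + suc j * 2 * (2 ^ n * C₁ k)
    ≡⟨ cong₂ _+_ (cong₂ (λ x y → j * 2 * x + 2 * y) (C₀≈S k) (shift-scaled n 1 C₀ S C₀≈S k))
                 (cong (suc j * 2 *_) (C₁≈S k)) ⟩
  j * 2 * (1 * (2 ^ k * S k)) + 2 * (1 * (2 ^ k * shift S k)) + suc j * 2 * (1 * (2 ^ k * S k))
    ≡⟨ collect j (2 ^ k) (S k) (shift S k) ⟩
  2 * (2 ^ k * ((1 + j * 2) * S k + shift S k))
    ≡⟨ cong (λ z → 2 * (2 ^ k * z)) (subsetSum-∷ (2 + j * 2) as k) ⟨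
  2 * (2 ^ k * subsetSum (2 + j * 2 ∷ as) k) ∎
  where
  open ≡-Reasoning
  C₀ = sameParityCount as 0ℙ
  C₁ = sameParityCount as 1ℙ
  S = subsetSum as
  C₀≈S = allOdd⇒sameParityCount as as-odd 0ℙ
  C₁≈S = allOdd⇒sameParityCount as as-odd 1ℙ
  distribute : ∀ p j c₀ s₀ c₁ → 2 * p * ((j * c₀ + 2 * s₀) + suc j * c₁)
                                ≡ j * 2 * (p * c₀) + 2 * (2 * (p * s₀)) + suc j * 2 * (p * c₁)
  distribute = solve-∀
  collect : ∀ j p g s → j * 2 * (1 * (p * g)) + 2 * (1 * (p * s)) + suc j * 2 * (1 * (p * g)) ≡ 2 * (p * ((1 + j * 2) * g + s))
  collect = solve-∀

pairwiseCoprime⇒sameParityTotal : ∀ {n} (as : Vec ℕ n) → All (0 <_) as → AllPairs Coprime as →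
                                   ∀ k → 2 ^ n * sameParityTotal as k ≡ 2 * (2 ^ k * subsetSum as k)
pairwiseCoprime⇒sameParityTotal []       []           []         zero    = refl
pairwiseCoprime⇒sameParityTotal []       []           []         (suc k) = sym (cong (2 *_) (*-zeroʳ (2 ^ suc k)))
pairwiseCoprime⇒sameParityTotal {suc n} (x ∷ as) (x>0 ∷ as>0) (c ∷ cs) k with parity x in x-parity
... | 1ℙ with odd⇒1+j*2 {x} x-parity
...   | j , refl = trans (cong (2 ^ suc n *_) (sameParityTotal-odd j as k))
                         (odd-step 2 j as _ (pairwiseCoprime⇒sameParityTotal as as>0 cs) k)
pairwiseCoprime⇒sameParityTotal {suc n} (x ∷ as) (x>0 ∷ as>0) (c ∷ cs) k | 0ℙ with even⇒j*2 {x} x-parity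
... | suc j , refl = allOdd⇒sameParityTotal-even∷ j as (All.map (even-coprime⇒odd x-parity) c) k

lemma4 : (n : ℕ) → 1 ≤ n → (a : Vec ℕ n) →
    (∀ i → 0 < lookup a i) →
    (∀ i j → i ≢ j → Coprime (lookup a i) (lookup a j)) →
    (k : ℕ) → k ≤ n →
    2 ^ n * bCount a k ≡ 2 ^ (1 + k) * subsetSum a k
lemma4 (suc n) _ a pos cop k _ = begin
  2 ^ suc n * bCount a k               ≡⟨ cong (2 ^ suc n *_) (bCount≡sameParityTotal a>0 a-cop k) ⟩
  2 ^ suc n * sameParityTotal a k      ≡⟨ pairwiseCoprime⇒sameParityTotal a a>0 a-cop k ⟩
  2 * (2 ^ k * subsetSum a k)          ≡⟨ *-assoc 2 (2 ^ k) (subsetSum a k) ⟨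
  2 ^ (1 + k) * subsetSum a k          ∎
  where
  open ≡-Reasoning
  a>0 : All (0 <_) a
  a>0 = All.lookup⁻ pos
  a-cop : AllPairs Coprime a
  a-cop = subst (AllPairs Coprime) (V.tabulate∘lookup a) (AllPairs.tabulate⁺ (λ {i} {j} → cop i j))
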